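{- Let $m\ge 2$ be an integer and let $A(\mathcal{D}_m)$ be as defined in the context. Suppose there exist natural numbers $n_0,a,b$ such that $A(\mathcal{D}_m)^{n_0+a}=b\boxtimes A(\mathcal{D}_m)^{n_0}$. Then $$\gamma_2(P_m\Box C_{n+a})-\gamma_2(P_m\Box C_n)=b$$ for every integer $n\ge n_0$ with $n\ge 3$.
   Context: $P_m$ is the path on $m$ vertices and $C_n$ the cycle on $n$ vertices ($n\ge 3$). The Cartesian product $G\Box H$ has vertex set $V(G)\times V(H)$, with $(g_1,h_1)\sim(g_2,h_2)$ iff either $g_1=g_2$ and $h_1h_2\in E(H)$, or $g_1g_2\in E(G)$ and $h_1=h_2$. A $2$-dominating set of a graph $G$ is a set $S\subseteq V(G)$ such that every vertex not in $S$ has at least two neighbours in $S$; $\gamma_2(G)$ is the minimum cardinality of a $2$-dominating set. A correct $m$-word is a word $p=(p_1,\dots,p_m)$ over $\{0,1,2\}$ that contains none of $020,111,211,112,212$ as a block of consecutive letters, whose first two letters are neither $11$ nor $12$, and whose last two letters are neither $11$ nor $21$. For correct $m$-words $q,p$, say $p$ can follow $q$ if for every $i$: (i) $q_i=2$ implies $p_i=0$; (ii) $p_i=2$ implies exactly one of $p_{i-1},p_{i+1},q_i$ equals $0$; (iii) $p_i=1$ implies at least two of $p_{i-1},p_{i+1},q_i$ equal $0$; letters with index $0$ or $m+1$ are omitted from these lists. $\mathcal{D}_m$ is the digraph on the correct $m$-words with an arc $q\to p$ iff $p$ can follow $q$. $A(\mathcal{D}_m)$ is the matrix indexed by correct $m$-words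 with $A(\mathcal{D}_m)_{qp}$ equal to the number of zeros of $p$ if $q\to p$ is an arc, and $\infty$ otherwise. Matrices are over the tropical semiring $(\mathbb{R}\cup\{\infty\},\min,+)$: $(A\boxtimes B)_{ij}=\min_k(a_{ik}+b_{kj})$, $M^k$ is the $k$-fold $(\min,+)$ product, and for a scalar $\alpha$, $(\alpha\boxtimes A)_{ij}=\alpha+a_{ij}$. -}

module Defs where

open import Data.Nat using (ℕ; zero; suc; _+_; _≤_; _≡ᵇ_; _≤ᵇ_; _⊓_)
open import Data.Bool using (Bool; true; false; _∧_; _∨_; not; if_then_else_)
open import Data.Fin using (Fin; toℕ)
open import Data.List using (List; []; _∷_; map; allFin; filter; foldr; concatMap)
open import Data.Nat.ListAction using (sum)
open import Data.Vec as Vec using (Vec)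
open import Data.Maybe using (Maybe; just; nothing)
open import Data.Product using (Σ; _×_; _,_)
open import Relation.Binary.PropositionalEquality using (_≡_)

-- Tropical semiring (ℕ ∪ {∞}, min, +)
-- (all matrix entries in this paper are natural numbers or ∞)

data ℕ∞ : Set where
  fin : ℕ → ℕ∞
  ∞   : ℕ∞

_⊕_ : ℕ∞ → ℕ∞ → ℕ∞
fin x ⊕ fin y = fin (x ⊓ y)
fin x ⊕ ∞     = fin x
∞     ⊕ y     = y

_⊗_ : ℕ∞ → ℕ∞ → ℕ∞
fin x ⊗ fin y = fin (x + y)
fin x ⊗ ∞     = ∞
∞     ⊗ y     = ∞

data Letter : Set where
  𝟎 𝟏 𝟐 : Letter

isZero : Letter → Bool
isZero 𝟎 = true
isZero _ = false

Word : ℕ → Set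
Word m = Vec Letter m

zeros : ∀ {m} → Word m → ℕ
zeros p = sum (map (λ x → if isZero x then 1 else 0) (Vec.toList p))

badBlock : Letter → Letter → Letter → Bool
badBlock 𝟎 𝟐 𝟎 = true
badBlock 𝟏 𝟏 𝟏 = true
badBlock 𝟐 𝟏 𝟏 = true
badBlock 𝟏 𝟏 𝟐 = true
badBlock 𝟐 𝟏 𝟐 = true
badBlock _ _ _ = false

noBadBlock : List Letter → Bool
noBadBlock (x ∷ y ∷ z ∷ r) = not (badBlock x y z) ∧ noBadBlock (y ∷ z ∷ r)
noBadBlock _ = true

firstOK : List Letter → Bool
firstOK (𝟏 ∷ 𝟏 ∷ _) = false
firstOK (𝟏 ∷ 𝟐 ∷ _) = false
firstOK _ = true

lastOK : List Letter → Bool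
lastOK (𝟏 ∷ 𝟏 ∷ []) = false
lastOK (𝟐 ∷ 𝟏 ∷ []) = false
lastOK (_ ∷ y ∷ []) = true
lastOK (_ ∷ y ∷ z ∷ r) = lastOK (y ∷ z ∷ r)
lastOK _ = true

correct : ∀ {m} → Word m → Bool
correct p = noBadBlock l ∧ firstOK l ∧ lastOK l
  where l = Vec.toList p

zeroM : Maybe Letter → ℕ      -- omitted letters (index 0 or m+1) count as non-zero
zeroM (just 𝟎) = 1
zeroM _ = 0

headM : List Letter → Maybe Letter
headM [] = nothing
headM (x ∷ _) = just x

cond1 : Letter → Letter → Bool
cond1 𝟐 𝟎 = true
cond1 𝟐 _ = false
cond1 _ _ = true

-- (ii) p_i = 2 ⇒ exactly one of the listed letters is 0;
-- (iii) p_i = 1 ⇒ at least two of them are 0   (k = number of zeros among them)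
cond23 : Letter → ℕ → Bool
cond23 𝟐 k = k ≡ᵇ 1
cond23 𝟏 k = 2 ≤ᵇ k
cond23 𝟎 k = true

posOK : Maybe Letter → Maybe Letter → Letter → Letter → Bool
posOK prev next qi pi =
  cond1 qi pi ∧ cond23 pi (zeroM prev + zeroM next + zeroM (just qi))

followsAux : Maybe Letter → List Letter → List Letter → Bool
followsAux prev (qi ∷ qs) (pi ∷ ps) = posOK prev (headM ps) qi pi ∧ followsAux (just pi) qs ps
followsAux _ _ _ = true

canFollow : ∀ {m} → Word m → Word m → Bool     -- canFollow q p : p can follow q
canFollow q p = followsAux nothing (Vec.toList q) (Vec.toList p)

allWords : (m : ℕ) → List (Word m)
allWords zero = Vec.[] ∷ []
allWords (suc m) = concatMap (λ w → map (λ x → x Vec.∷ w) (𝟎 ∷ 𝟏 ∷ 𝟐 ∷ [])) (allWords m)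

correctWords : (m : ℕ) → List (Word m)
correctWords m = filter (λ w → Data.Bool._≟_ (correct w) true) (allWords m)

Matrix : ℕ → Set
Matrix m = Word m → Word m → ℕ∞

-- only entries with both indices correct words are meaningful
AD : (m : ℕ) → Matrix m
AD m q p = if canFollow q p then fin (zeros p) else ∞

_⊠_ : ∀ {m} → Matrix m → Matrix m → Matrix m
_⊠_ {m} A B i j = foldr (λ k acc → (A i k ⊗ B k j) ⊕ acc) ∞ (correctWords m)

I : ∀ {m} → Matrix m
I q p = if eqW q p then fin 0 else ∞
  where
  eqL : Letter → Letter → Bool
  eqL 𝟎 𝟎 = true
  eqL 𝟏 𝟏 = true
  eqL 𝟐 𝟐 = true
  eqL _ _ = false
  eqW : ∀ {k} → Word k → Word k → Bool
  eqW Vec.[] Vec.[] = true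
  eqW (x Vec.∷ xs) (y Vec.∷ ys) = eqL x y ∧ eqW xs ys

_^_ : ∀ {m} → Matrix m → ℕ → Matrix m
M ^ zero = I
M ^ suc k = M ⊠ (M ^ k)

_·_ : ∀ {m} → ℕ → Matrix m → Matrix m
(α · A) i j = fin α ⊗ A i j

pathAdj : ∀ {m} → Fin m → Fin m → Bool
pathAdj i i' = (suc (toℕ i) ≡ᵇ toℕ i') ∨ (suc (toℕ i') ≡ᵇ toℕ i)

cycSucc : (n : ℕ) → Fin n → Fin n → Bool
cycSucc n j j' = (suc (toℕ j) ≡ᵇ toℕ j') ∨ ((suc (toℕ j) ≡ᵇ n) ∧ (toℕ j' ≡ᵇ 0))

cycAdj : (n : ℕ) → Fin n → Fin n → Bool
cycAdj n j j' = cycSucc n j j' ∨ cycSucc n j' j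

eqFin : ∀ {k} → Fin k → Fin k → Bool
eqFin x y = toℕ x ≡ᵇ toℕ y

Vertex : ℕ → ℕ → Set
Vertex m n = Fin m × Fin n

adjPC : (m n : ℕ) → Vertex m n → Vertex m n → Bool
adjPC m n (i , j) (i' , j') = (eqFin i i' ∧ cycAdj n j j') ∨ (pathAdj i i' ∧ eqFin j j')

VSet : ℕ → ℕ → Set
VSet m n = Vertex m n → Bool

card : ∀ {m n} → VSet m n → ℕ
card {m} {n} S = sum (map (λ i → sum (map (λ j → if S (i , j) then 1 else 0) (allFin n))) (allFin m))

nbrsIn : ∀ {m n} → VSet m n → Vertex m n → ℕ
nbrsIn {m} {n} S u = card {m} {n} (λ v → adjPC m n u v ∧ S v)

Is2Dominating : (m n : ℕ) → VSet m n → Set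
Is2Dominating m n S = ∀ u → S u ≡ false → 2 ≤ nbrsIn S u

IsGamma2PC : (m n : ℕ) → ℕ → Set
IsGamma2PC m n k =
  Σ (VSet m n) (λ S → Is2Dominating m n S × card S ≡ k)
  × (∀ S → Is2Dominating m n S → k ≤ card S)

module Submission where

-- Reading column j of P_m □ C_n as a word over {0,1,2}, with 0 on the vertices of a set S,
-- a vertex outside S gets 1 when two of its neighbours in S lie in its own column or in
-- column j - 1, and 2 when it still needs its neighbour in column j + 1.  This turns the
-- 2-dominating sets of P_m □ C_n (n ≥ 3) into the closed walks of length n in D_m, with |S|
-- the number of zeros along the walk, so γ₂(P_m □ C_n) is the least diagonal entry of
-- A(D_m)^n at a correct word.  The relation A^(n₀+a) = b ⊠ A^n₀ on correct words propagates
-- to every n ≥ n₀, and shifts that least entry by b.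

open import Defs
open import Algebra.Properties.CommutativeSemigroup using (x∙yz≈y∙xz)
open import Data.Bool using (Bool; true; false; _∧_; _∨_; not; if_then_else_; T)
open import Data.Bool.Properties
  using (∧-conicalˡ; ∧-conicalʳ; ∧-identityʳ; ∧-zeroʳ; ∨-identityʳ; ¬-not; T-≡)
open import Data.Empty using (⊥-elim)
open import Data.Fin using (Fin; toℕ; fromℕ; fromℕ<; inject₁) renaming (zero to fzero; suc to fsuc)
open import Data.Fin.Properties
  using (toℕ-injective; toℕ<n; toℕ-fromℕ; toℕ-fromℕ<; toℕ-inject₁; toℕ-inject₁-≢)
open import Data.List using (List; []; _∷_; foldr; map; allFin; tabulate)
open import Data.List.Membership.Propositional using (_∈_)
open import Data.List.Membership.Propositional.Properties using (∈-filter⁺; ∈-concatMap⁺)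
open import Data.List.Properties using (map-tabulate)
open import Data.List.Relation.Unary.All as All using (All)
open import Data.List.Relation.Unary.All.Properties using (all-filter)
open import Data.List.Relation.Unary.Any as Any using (here; there)
open import Data.Maybe using (Maybe; just; nothing)
open import Data.Nat
  using (ℕ; zero; suc; _+_; _⊓_; _≤_; _<_; _≤′_; ≤′-refl; ≤′-step; z≤n; s≤s; s≤s⁻¹; _≡ᵇ_; _≤ᵇ_)
open import Data.Nat.ListAction using (sum)
open import Data.Nat.Properties
open import Data.Nat.Solver using (module +-*-Solver)
open import Algebra.Properties.CommutativeMonoid.Sum +-0-commutativeMonoid
  using (sum-syntax; sum-cong-≗; ∑-distrib-+; ∑-comm; sum-replicate-zero)
open import Data.Product using (Σ-syntax; ∃-syntax; ∃₂; _×_; _,_)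
open import Data.Sum using (_⊎_; inj₁; inj₂)
open import Data.Vec as Vec using ([]; _∷_)
open import Data.Vec.Properties using (lookup∘tabulate)
open import Function using (_∘_; Equivalence)
open import Relation.Binary.PropositionalEquality
open import Relation.Nullary using (yes; no)
open +-*-Solver using (solve; _:+_; _:=_)

∧-intro : ∀ {a b} → a ≡ true → b ≡ true → a ∧ b ≡ true
∧-intro refl refl = refl

_⇒ᵇ_ : Bool → Bool → Bool
a ⇒ᵇ b = not a ∨ b

⇒ᵇ-elim : ∀ {a b} → (a ⇒ᵇ b) ≡ true → a ≡ true → b ≡ true
⇒ᵇ-elim h refl = h

≡ᵇ-complete : ∀ {m n} → m ≡ n → (m ≡ᵇ n) ≡ true
≡ᵇ-complete {m} {n} m≡n = Equivalence.to T-≡ (≡⇒≡ᵇ m n m≡n)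

≡ᵇ-sound : ∀ {m n} → (m ≡ᵇ n) ≡ true → m ≡ n
≡ᵇ-sound {m} {n} h = ≡ᵇ⇒≡ m n (Equivalence.from T-≡ h)

≡ᵇ-false : ∀ {m n} → m ≢ n → (m ≡ᵇ n) ≡ false
≡ᵇ-false m≢n = ¬-not (m≢n ∘ ≡ᵇ-sound)

≤ᵇ-sound : ∀ {m n} → (m ≤ᵇ n) ≡ true → m ≤ n
≤ᵇ-sound {m} {n} h = ≤ᵇ⇒≤ m n (Equivalence.from T-≡ h)

≤ᵇ-false : ∀ {m n} → (m ≤ᵇ n) ≡ false → n < m
≤ᵇ-false h = ≰⇒> (λ m≤n → subst T h (≤⇒≤ᵇ m≤n))

≡ᵇ-sym : ∀ m n → (m ≡ᵇ n) ≡ (n ≡ᵇ m)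
≡ᵇ-sym zero    zero    = refl
≡ᵇ-sym zero    (suc n) = refl
≡ᵇ-sym (suc m) zero    = refl
≡ᵇ-sym (suc m) (suc n) = ≡ᵇ-sym m n

≡ᵇ-disjoint : ∀ {a b} c → a ≢ b → ((a ≡ᵇ c) ∧ (b ≡ᵇ c)) ≡ false
≡ᵇ-disjoint {a} {b} c a≢b with a ≡ᵇ c in a≡c | b ≡ᵇ c in b≡c
... | true  | true  = ⊥-elim (a≢b (trans (≡ᵇ-sound a≡c) (sym (≡ᵇ-sound b≡c))))
... | true  | false = refl
... | false | _     = refl

χ : Bool → ℕ
χ b = if b then 1 else 0

when : Bool → ℕ → ℕ
when b v = if b then v else 0

χ-∧ : ∀ a b → χ (a ∧ b) ≡ when a (χ b)
χ-∧ true  b = refl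
χ-∧ false b = refl

when-∧ : ∀ a b v → when (a ∧ b) v ≡ when a (when b v)
when-∧ true  b v = refl
when-∧ false b v = refl

when-∨ : ∀ a b v → a ∧ b ≡ false → when (a ∨ b) v ≡ when a v + when b v
when-∨ true  false v _ = sym (+-identityʳ v)
when-∨ false b     v _ = refl

χ≤1 : ∀ b → χ b ≤ 1
χ≤1 true  = ≤-refl
χ≤1 false = z≤n

χ-positive : ∀ b → 1 ≤ χ b → b ≡ true
χ-positive true _ = refl

infix 4 _≤∞_
_≤∞_ : ℕ∞ → ℕ → Set
x ≤∞ w = ∃[ v ] x ≡ fin v × v ≤ w

fin-injective : ∀ {a b} → fin a ≡ fin b → a ≡ b
fin-injective refl = refl

⊗-finite : ∀ {u v x} → u ⊗ v ≡ fin x → ∃₂ λ a b → u ≡ fin a × v ≡ fin b × a + b ≡ x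
⊗-finite {fin a} {fin b} a+b≡x = a , b , refl , refl , fin-injective a+b≡x

fin⊗-finite : ∀ b {v x} → fin b ⊗ v ≡ fin x → ∃[ y ] v ≡ fin y × b + y ≡ x
fin⊗-finite b {fin y} b+y≡x = y , refl , fin-injective b+y≡x

⊗-monoʳ-≤∞ : ∀ a {y v} → y ≤∞ v → fin a ⊗ y ≤∞ a + v
⊗-monoʳ-≤∞ a (u , refl , u≤v) = a + u , refl , +-monoʳ-≤ a u≤v

⊗-swapˡ : ∀ u v w → u ⊗ (v ⊗ w) ≡ v ⊗ (u ⊗ w)
⊗-swapˡ (fin u) (fin v) (fin w) = cong fin (x∙yz≈y∙xz +-commutativeSemigroup u v w)
⊗-swapˡ (fin u) (fin v) ∞       = refl
⊗-swapˡ (fin u) ∞       w       = refl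
⊗-swapˡ ∞       (fin v) w       = refl
⊗-swapˡ ∞       ∞       w       = refl

⊗-zeroʳ : ∀ w → w ⊗ ∞ ≡ ∞
⊗-zeroʳ (fin w) = refl
⊗-zeroʳ ∞       = refl

⊗-distribˡ-⊕ : ∀ w u v → w ⊗ (u ⊕ v) ≡ (w ⊗ u) ⊕ (w ⊗ v)
⊗-distribˡ-⊕ (fin w) (fin u) (fin v) = cong fin (+-distribˡ-⊓ w u v)
⊗-distribˡ-⊕ (fin w) (fin u) ∞       = refl
⊗-distribˡ-⊕ (fin w) ∞       v       = refl
⊗-distribˡ-⊕ ∞       u       v       = refl

⊕-selective : ∀ x y {z} → x ⊕ y ≡ fin z → x ≡ fin z ⊎ y ≡ fin z
⊕-selective (fin x) (fin y) refl with ⊓-sel x y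
... | inj₁ x⊓y≡x = inj₁ (cong fin (sym x⊓y≡x))
... | inj₂ x⊓y≡y = inj₂ (cong fin (sym x⊓y≡y))
⊕-selective (fin x) ∞ x≡z = inj₁ x≡z
⊕-selective ∞       y y≡z = inj₂ y≡z

⊕-≤∞ˡ : ∀ {x v} y → x ≤∞ v → x ⊕ y ≤∞ v
⊕-≤∞ˡ (fin y) (u , refl , u≤v) = u ⊓ y , refl , ≤-trans (m⊓n≤m u y) u≤v
⊕-≤∞ˡ ∞       (u , refl , u≤v) = u , refl , u≤v

⊕-≤∞ʳ : ∀ x {y v} → y ≤∞ v → x ⊕ y ≤∞ v
⊕-≤∞ʳ (fin x) (u , refl , u≤v) = x ⊓ u , refl , ≤-trans (m⊓n≤n x u) u≤v
⊕-≤∞ʳ ∞       y≤v              = y≤v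

⨁ : {A : Set} → List A → (A → ℕ∞) → ℕ∞
⨁ L f = foldr (λ k acc → f k ⊕ acc) ∞ L

⨁-attained : ∀ {A : Set} (L : List A) f {x} → ⨁ L f ≡ fin x → ∃[ k ] f k ≡ fin x
⨁-attained (k ∷ L) f h with ⊕-selective (f k) (⨁ L f) h
... | inj₁ fk≡x = k , fk≡x
... | inj₂ rest≡x = ⨁-attained L f rest≡x

⨁-≤∞ : ∀ {A : Set} {L : List A} f {k v} → k ∈ L → f k ≤∞ v → ⨁ L f ≤∞ v
⨁-≤∞ {L = k ∷ L} f (here refl) fk≤v = ⊕-≤∞ˡ (⨁ L f) fk≤v
⨁-≤∞ {L = k ∷ L} f (there k∈L) fk≤v = ⊕-≤∞ʳ (f k) (⨁-≤∞ f k∈L fk≤v)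

⨁-scale : ∀ {A : Set} {L : List A} {f g} w → All (λ k → f k ≡ w ⊗ g k) L → ⨁ L f ≡ w ⊗ ⨁ L g
⨁-scale w All.[] = sym (⊗-zeroʳ w)
⨁-scale {L = k ∷ L} {f} {g} w (fk≡ All.∷ rest) = begin
  f k ⊕ ⨁ L f                ≡⟨ cong₂ _⊕_ fk≡ (⨁-scale w rest) ⟩
  (w ⊗ g k) ⊕ (w ⊗ ⨁ L g)    ≡⟨ sym (⊗-distribˡ-⊕ w (g k) (⨁ L g)) ⟩
  w ⊗ (g k ⊕ ⨁ L g)          ∎
  where open ≡-Reasoning

-- Eventual periodicity of the powers of A(D_m)

allWords-complete : ∀ {m} (w : Word m) → w ∈ allWords m
allWords-complete []      = here refl
allWords-complete (x ∷ w) =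
  ∈-concatMap⁺ (λ w → map (_∷ w) (𝟎 ∷ 𝟏 ∷ 𝟐 ∷ []))
               (Any.map (λ { refl → prepended x }) (allWords-complete w))
  where
  prepended : ∀ x → (x ∷ w) ∈ map (_∷ w) (𝟎 ∷ 𝟏 ∷ 𝟐 ∷ [])
  prepended 𝟎 = here refl
  prepended 𝟏 = there (here refl)
  prepended 𝟐 = there (there (here refl))

correctWords-complete : ∀ {m} {w : Word m} → correct w ≡ true → w ∈ correctWords m
correctWords-complete {w = w} = ∈-filter⁺ (λ w → Data.Bool._≟_ (correct w) true) (allWords-complete w)

correctWords-correct : ∀ m → All (λ w → correct w ≡ true) (correctWords m)
correctWords-correct m = all-filter (λ w → Data.Bool._≟_ (correct w) true) (allWords m)

infix 4 _≈ᶜ_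
_≈ᶜ_ : ∀ {m} → Matrix m → Matrix m → Set
_≈ᶜ_ {m} M M′ = ∀ (q p : Word m) → correct q ≡ true → correct p ≡ true → M q p ≡ M′ q p

⊠-scaledʳ : ∀ {m} (L M M′ : Matrix m) b → M ≈ᶜ (b · M′) → (L ⊠ M) ≈ᶜ (b · (L ⊠ M′))
⊠-scaledʳ {m} L M M′ b M≈bM′ q p _ cp = ⨁-scale (fin b) (All.map scaled (correctWords-correct m))
  where
  scaled : ∀ {k} → correct k ≡ true → L q k ⊗ M k p ≡ fin b ⊗ (L q k ⊗ M′ k p)
  scaled {k} ck = trans (cong (L q k ⊗_) (M≈bM′ k p ck cp)) (⊗-swapˡ (L q k) (fin b) (M′ k p))

^-periodic : ∀ {m} (M : Matrix m) {n₀ a b} → (M ^ (n₀ + a)) ≈ᶜ (b · (M ^ n₀)) →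
  ∀ {n} → n₀ ≤′ n → (M ^ (n + a)) ≈ᶜ (b · (M ^ n))
^-periodic M h ≤′-refl         = h
^-periodic M h (≤′-step n₀≤′n) = ⊠-scaledʳ M _ _ _ (^-periodic M h n₀≤′n)

∀ᴸ : (Letter → Bool) → Bool
∀ᴸ P = P 𝟎 ∧ P 𝟏 ∧ P 𝟐

∀ᴸ-sound : (P : Letter → Bool) → ∀ᴸ P ≡ true → ∀ x → P x ≡ true
∀ᴸ-sound P h 𝟎 = ∧-conicalˡ _ _ h
∀ᴸ-sound P h 𝟏 = ∧-conicalˡ _ _ (∧-conicalʳ (P 𝟎) _ h)
∀ᴸ-sound P h 𝟐 = ∧-conicalʳ _ _ (∧-conicalʳ (P 𝟎) _ h)

∀ᴸ³ : (Letter → Letter → Letter → Bool) → Bool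
∀ᴸ³ P = ∀ᴸ λ x → ∀ᴸ λ y → ∀ᴸ (P x y)

∀ᴸ³-sound : (P : Letter → Letter → Letter → Bool) → ∀ᴸ³ P ≡ true → ∀ x y z → P x y z ≡ true
∀ᴸ³-sound P h x y =
  ∀ᴸ-sound (P x y) (∀ᴸ-sound (λ y → ∀ᴸ (P x y)) (∀ᴸ-sound (λ x → ∀ᴸ λ y → ∀ᴸ (P x y)) h x) y)

letterBefore : ∀ {k} → Maybe Letter → Word k → Fin k → Maybe Letter
letterBefore pr (x ∷ p) fzero    = pr
letterBefore pr (x ∷ p) (fsuc i) = letterBefore (just x) p i

letterAfter : ∀ {k} → Word k → Fin k → Maybe Letter
letterAfter (x ∷ p) fzero    = headM (Vec.toList p)
letterAfter (x ∷ p) (fsuc i) = letterAfter p i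

FollowsAt : ∀ {k} → Maybe Letter → Word k → Word k → Set
FollowsAt pr q p = ∀ i → posOK (letterBefore pr p i) (letterAfter p i) (Vec.lookup q i) (Vec.lookup p i) ≡ true

followsAux⇒FollowsAt : ∀ {k} pr (q p : Word k) →
  followsAux pr (Vec.toList q) (Vec.toList p) ≡ true → FollowsAt pr q p
followsAux⇒FollowsAt pr (a ∷ q) (x ∷ p) h fzero    = ∧-conicalˡ _ _ h
followsAux⇒FollowsAt pr (a ∷ q) (x ∷ p) h (fsuc i) = followsAux⇒FollowsAt (just x) q p (∧-conicalʳ _ _ h) i

FollowsAt⇒followsAux : ∀ {k} pr (q p : Word k) →
  FollowsAt pr q p → followsAux pr (Vec.toList q) (Vec.toList p) ≡ true
FollowsAt⇒followsAux pr []      []      h = refl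
FollowsAt⇒followsAux pr (a ∷ q) (x ∷ p) h = ∧-intro (h fzero) (FollowsAt⇒followsAux (just x) q p (h ∘ fsuc))

posOK⇒¬badBlock : ∀ x y z q → posOK (just x) (just z) q y ≡ true → not (badBlock x y z) ≡ true
posOK⇒¬badBlock x y z q =
  ⇒ᵇ-elim (∀ᴸ-sound (P x y z) (∀ᴸ³-sound (λ x y z → ∀ᴸ (P x y z)) refl x y z) q)
  where
  P : Letter → Letter → Letter → Letter → Bool
  P x y z q = posOK (just x) (just z) q y ⇒ᵇ not (badBlock x y z)

posOK⇒firstOK : ∀ x y q r → posOK nothing (just y) q x ≡ true → firstOK (x ∷ y ∷ r) ≡ true
posOK⇒firstOK x y q r =
  ⇒ᵇ-elim (∀ᴸ³-sound (λ x y q → posOK nothing (just y) q x ⇒ᵇ firstOK (x ∷ y ∷ r)) refl x y q)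

posOK⇒lastOK : ∀ x y q → posOK (just x) nothing q y ≡ true → lastOK (x ∷ y ∷ []) ≡ true
posOK⇒lastOK x y q =
  ⇒ᵇ-elim (∀ᴸ³-sound (λ x y q → posOK (just x) nothing q y ⇒ᵇ lastOK (x ∷ y ∷ [])) refl x y q)

lastOK-∷ : ∀ x y z r → lastOK (x ∷ y ∷ z ∷ r) ≡ lastOK (y ∷ z ∷ r)
lastOK-∷ 𝟎 y z r = refl
lastOK-∷ 𝟏 𝟎 z r = refl
lastOK-∷ 𝟏 𝟏 z r = refl
lastOK-∷ 𝟏 𝟐 z r = refl
lastOK-∷ 𝟐 𝟎 z r = refl
lastOK-∷ 𝟐 𝟏 z r = refl
lastOK-∷ 𝟐 𝟐 z r = refl

followsAux⇒noBadBlock : ∀ {k} pr (q p : Word k) → followsAux pr (Vec.toList q) (Vec.toList p) ≡ true →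
  noBadBlock (Vec.toList p) ≡ true
followsAux⇒noBadBlock pr []              []              h = refl
followsAux⇒noBadBlock pr (_ ∷ [])        (_ ∷ [])        h = refl
followsAux⇒noBadBlock pr (_ ∷ _ ∷ [])    (_ ∷ _ ∷ [])    h = refl
followsAux⇒noBadBlock pr (a ∷ b ∷ c ∷ q) (x ∷ y ∷ z ∷ p) h =
  ∧-intro (posOK⇒¬badBlock x y z b (∧-conicalˡ _ _ rest))
          (followsAux⇒noBadBlock (just x) (b ∷ c ∷ q) (y ∷ z ∷ p) rest)
  where rest = ∧-conicalʳ (posOK pr (just y) a x) _ h

canFollow⇒firstOK : ∀ {k} (q p : Word k) → canFollow q p ≡ true → firstOK (Vec.toList p) ≡ true
canFollow⇒firstOK []          []          h = refl
canFollow⇒firstOK (_ ∷ [])    (x ∷ [])    h = ∀ᴸ-sound (λ x → firstOK (x ∷ [])) refl x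
canFollow⇒firstOK (a ∷ _ ∷ _) (x ∷ y ∷ p) h = posOK⇒firstOK x y a (Vec.toList p) (∧-conicalˡ _ _ h)

followsAux⇒lastOK : ∀ {k} pr (q p : Word k) → followsAux pr (Vec.toList q) (Vec.toList p) ≡ true →
  lastOK (Vec.toList p) ≡ true
followsAux⇒lastOK pr []              []              h = refl
followsAux⇒lastOK pr (_ ∷ [])        (x ∷ [])        h = ∀ᴸ-sound (λ x → lastOK (x ∷ [])) refl x
followsAux⇒lastOK pr (a ∷ b ∷ [])    (x ∷ y ∷ [])    h =
  posOK⇒lastOK x y b (∧-conicalˡ _ _ (∧-conicalʳ (posOK pr (just y) a x) _ h))
followsAux⇒lastOK pr (a ∷ b ∷ c ∷ q) (x ∷ y ∷ z ∷ p) h =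
  trans (lastOK-∷ x y z (Vec.toList p))
        (followsAux⇒lastOK (just x) (b ∷ c ∷ q) (y ∷ z ∷ p) (∧-conicalʳ (posOK pr (just y) a x) _ h))

canFollow⇒correct : ∀ {k} (q p : Word k) → canFollow q p ≡ true → correct p ≡ true
canFollow⇒correct q p h =
  ∧-intro (followsAux⇒noBadBlock nothing q p h)
          (∧-intro (canFollow⇒firstOK q p h) (followsAux⇒lastOK nothing q p h))

-- Walks in D_m

I-diagonal : ∀ {k} (q : Word k) → I q q ≡ fin 0
I-diagonal []      = refl
I-diagonal (𝟎 ∷ q) = I-diagonal q
I-diagonal (𝟏 ∷ q) = I-diagonal q
I-diagonal (𝟐 ∷ q) = I-diagonal q

I-finite : ∀ {k} (q p : Word k) {x} → I q p ≡ fin x → q ≡ p × x ≡ 0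
I-finite []      []      refl = refl , refl
I-finite (𝟎 ∷ q) (𝟎 ∷ p) h with I-finite q p h
... | refl , x≡0 = refl , x≡0
I-finite (𝟏 ∷ q) (𝟏 ∷ p) h with I-finite q p h
... | refl , x≡0 = refl , x≡0
I-finite (𝟐 ∷ q) (𝟐 ∷ p) h with I-finite q p h
... | refl , x≡0 = refl , x≡0
I-finite (𝟎 ∷ q) (𝟏 ∷ p) ()
I-finite (𝟎 ∷ q) (𝟐 ∷ p) ()
I-finite (𝟏 ∷ q) (𝟎 ∷ p) ()
I-finite (𝟏 ∷ q) (𝟐 ∷ p) ()
I-finite (𝟐 ∷ q) (𝟎 ∷ p) ()
I-finite (𝟐 ∷ q) (𝟏 ∷ p) ()

AD-canFollow : ∀ {m} (q p : Word m) → canFollow q p ≡ true → AD m q p ≡ fin (zeros p)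
AD-canFollow q p q→p rewrite q→p = refl

AD-finite : ∀ {m} (q p : Word m) {a} → AD m q p ≡ fin a → canFollow q p ≡ true × zeros p ≡ a
AD-finite q p h with canFollow q p
... | true = refl , fin-injective h

record Walk (m n : ℕ) : Set where
  field
    vertex : ℕ → Word m
    step   : ∀ k → k < n → canFollow (vertex k) (vertex (suc k)) ≡ true

  source target : Word m
  source = vertex 0
  target = vertex n

  weight : ℕ
  weight = ∑[ k < n ] zeros (vertex (suc (toℕ k)))

open Walk

stay : ∀ {m} → Word m → Walk m 0
stay q = record { vertex = λ _ → q ; step = λ _ () }

prepend : ∀ {m n} (q : Word m) (w : Walk m n) → canFollow q (source w) ≡ true → Walk m (suc n)
prepend {m} {n} q w q→w = record { vertex = vertex′ ; step = step′ }
  where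
  vertex′ : ℕ → Word m
  vertex′ zero    = q
  vertex′ (suc k) = vertex w k
  step′ : ∀ k → k < suc n → canFollow (vertex′ k) (vertex′ (suc k)) ≡ true
  step′ zero    _           = q→w
  step′ (suc k) (s≤s k<n) = step w k k<n

drop₁ : ∀ {m n} → Walk m (suc n) → Walk m n
drop₁ w = record { vertex = vertex w ∘ suc ; step = λ k k<n → step w (suc k) (s≤s k<n) }

power-≤∞-weight : ∀ {m} n (w : Walk m n) → (AD m ^ n) (source w) (target w) ≤∞ weight w
power-≤∞-weight zero w = 0 , I-diagonal (source w) , z≤n
power-≤∞-weight {m} (suc n) w =
  ⨁-≤∞ (λ k → AD m (source w) k ⊗ (AD m ^ n) k (target w))
       (correctWords-complete (canFollow⇒correct (source w) (vertex w 1) first-step)) first-then-rest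
  where
  first-step = step w 0 (s≤s z≤n)
  first-then-rest : AD m (source w) (vertex w 1) ⊗ (AD m ^ n) (vertex w 1) (target w) ≤∞ weight w
  first-then-rest =
    subst (λ x → x ⊗ (AD m ^ n) (vertex w 1) (target w) ≤∞ weight w)
          (sym (AD-canFollow (source w) (vertex w 1) first-step))
          (⊗-monoʳ-≤∞ (zeros (vertex w 1)) (power-≤∞-weight n (drop₁ w)))

finite-power⇒walk : ∀ {m} n {q p x} → (AD m ^ n) q p ≡ fin x →
  Σ[ w ∈ Walk m n ] source w ≡ q × target w ≡ p × weight w ≡ x
finite-power⇒walk zero {q} {p} h with I-finite q p h
... | refl , refl = stay q , refl , refl , refl
finite-power⇒walk {m} (suc n) {q} {p} h
  with ⨁-attained (correctWords m) (λ k → AD m q k ⊗ (AD m ^ n) k p) h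
... | k , qkp≡x with ⊗-finite {AD m q k} qkp≡x
... | a , b , qk≡a , kp≡b , a+b≡x with AD-finite q k qk≡a | finite-power⇒walk n kp≡b
... | q→k , refl | w , refl , refl , refl = prepend q w q→k , refl , refl , a+b≡x

cycSuc : ∀ {n} → Fin (suc n) → Fin (suc n)
cycSuc {n} j with suc (toℕ j) <? suc n
... | yes j+1<1+n = fromℕ< j+1<1+n
... | no  _       = fzero

cycPred : ∀ {n} → Fin (suc n) → Fin (suc n)
cycPred {n} fzero    = fromℕ n
cycPred     (fsuc j) = inject₁ j

toℕ-cycSuc : ∀ {n} (j : Fin (suc n)) →
  (toℕ j < n × toℕ (cycSuc j) ≡ suc (toℕ j)) ⊎ (toℕ j ≡ n × cycSuc j ≡ fzero)
toℕ-cycSuc {n} j with suc (toℕ j) <? suc n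
... | yes j+1<1+n = inj₁ (s≤s⁻¹ j+1<1+n , toℕ-fromℕ< j+1<1+n)
... | no  j+1≮1+n = inj₂ (≤-antisym (s≤s⁻¹ (toℕ<n j)) (≮⇒≥ (j+1≮1+n ∘ s≤s)) , refl)

toℕ-cycPred : ∀ {n} (j : Fin (suc n)) {r} → toℕ j ≡ suc r → toℕ (cycPred j) ≡ r
toℕ-cycPred (fsuc j) j≡1+r = trans (toℕ-inject₁ j) (suc-injective j≡1+r)

cycPred-cycSuc : ∀ {n} (j : Fin (suc n)) → cycPred (cycSuc j) ≡ j
cycPred-cycSuc {n} j with toℕ-cycSuc j
... | inj₁ (_ , j⁺≡1+j) = toℕ-injective (toℕ-cycPred (cycSuc j) j⁺≡1+j)
... | inj₂ (j≡n , j⁺≡0)  = trans (cong cycPred j⁺≡0) (toℕ-injective (trans (toℕ-fromℕ n) (sym j≡n)))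

cycSuc-cycPred : ∀ {n} (j : Fin (suc n)) → cycSuc (cycPred j) ≡ j
cycSuc-cycPred {n} fzero with toℕ-cycSuc (cycPred {n} fzero)
... | inj₁ (n<n , _) = ⊥-elim (<-irrefl (toℕ-fromℕ n) n<n)
... | inj₂ (_ , e)   = e
cycSuc-cycPred (fsuc j) with toℕ-cycSuc (cycPred (fsuc j))
... | inj₁ (_ , e)   = toℕ-injective (trans e (cong suc (toℕ-inject₁ j)))
... | inj₂ (j≡n , _) = ⊥-elim (toℕ-inject₁-≢ j (sym j≡n))

cycSuc≢cycPred : ∀ {n} → 2 ≤ n → (j : Fin (suc n)) → toℕ (cycSuc j) ≢ toℕ (cycPred j)
cycSuc≢cycPred {n} 2≤n fzero with toℕ-cycSuc (fzero {n})
... | inj₁ (_ , j⁺≡1) = λ j⁺≡n → <⇒≢ 2≤n (trans (sym j⁺≡1) (trans j⁺≡n (toℕ-fromℕ n)))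
... | inj₂ (0≡n , _)  = ⊥-elim (<⇒≢ (≤-trans (s≤s z≤n) 2≤n) 0≡n)
cycSuc≢cycPred {n} 2≤n (fsuc j) with toℕ-cycSuc (fsuc j)
... | inj₁ (_ , j⁺≡2+j) = λ j⁺≡j →
  m≢1+n+m (toℕ j) {1} (sym (trans (sym j⁺≡2+j) (trans j⁺≡j (toℕ-inject₁ j))))
... | inj₂ (j+1≡n , j⁺≡0) = λ j⁺≡j →
  <⇒≢ 2≤n (trans (cong suc (trans (sym (cong toℕ j⁺≡0)) (trans j⁺≡j (toℕ-inject₁ j)))) j+1≡n)

cycSucc-cycSuc : ∀ {n} (j j′ : Fin (suc n)) → cycSucc (suc n) j j′ ≡ (toℕ (cycSuc j) ≡ᵇ toℕ j′)
cycSucc-cycSuc {n} j j′ with toℕ-cycSuc j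
... | inj₁ (j<n , j⁺≡1+j) rewrite j⁺≡1+j | ≡ᵇ-false (<⇒≢ j<n) = ∨-identityʳ _
... | inj₂ (j≡n , j⁺≡0)
  rewrite j⁺≡0 | ≡ᵇ-complete j≡n
        | ≡ᵇ-false (λ 1+j≡j′ → <⇒≢ (toℕ<n j′) (trans (sym 1+j≡j′) (cong suc j≡n)))
  = ≡ᵇ-sym (toℕ j′) 0

cycSucc-cycPred : ∀ {n} (j j′ : Fin (suc n)) → cycSucc (suc n) j′ j ≡ (toℕ (cycPred j) ≡ᵇ toℕ j′)
cycSucc-cycPred {n} fzero j′ rewrite ∧-identityʳ (toℕ j′ ≡ᵇ n) | toℕ-fromℕ n = ≡ᵇ-sym (toℕ j′) n
cycSucc-cycPred {n} (fsuc j) j′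
  rewrite ∧-zeroʳ (toℕ j′ ≡ᵇ n) | ∨-identityʳ (toℕ j′ ≡ᵇ toℕ j) | toℕ-inject₁ j
  = ≡ᵇ-sym (toℕ j′) (toℕ j)

cycSuc^ : ∀ {n} → ℕ → Fin (suc n)
cycSuc^ zero    = fzero
cycSuc^ (suc k) = cycSuc (cycSuc^ k)

toℕ-cycSuc^ : ∀ {n} k → k ≤ n → toℕ (cycSuc^ {n} k) ≡ k
toℕ-cycSuc^ zero _ = refl
toℕ-cycSuc^ {n} (suc k) k<n with toℕ-cycSuc (cycSuc^ {n} k)
... | inj₁ (_ , e)   = trans e (cong suc (toℕ-cycSuc^ k (<⇒≤ k<n)))
... | inj₂ (k≡n , _) = ⊥-elim (<⇒≢ k<n (trans (sym (toℕ-cycSuc^ k (<⇒≤ k<n))) k≡n))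

cycSuc^-period : ∀ {n} → cycSuc^ {n} (suc n) ≡ fzero
cycSuc^-period {n} with toℕ-cycSuc (cycSuc^ {n} n)
... | inj₁ (n<n , _) = ⊥-elim (<-irrefl (toℕ-cycSuc^ n ≤-refl) n<n)
... | inj₂ (_ , e)   = e

cycSuc^-toℕ : ∀ {n} (j : Fin (suc n)) → cycSuc^ (toℕ j) ≡ j
cycSuc^-toℕ j = toℕ-injective (toℕ-cycSuc^ (toℕ j) (s≤s⁻¹ (toℕ<n j)))

∑-when : ∀ k b (f : Fin k → ℕ) → ∑[ x < k ] when b (f x) ≡ when b (∑[ x < k ] f x)
∑-when k true  f = refl
∑-when k false f = sum-replicate-zero k

sum-map-allFin : ∀ k (g : Fin k → ℕ) → sum (map g (allFin k)) ≡ ∑[ x < k ] g x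
sum-map-allFin k g = trans (cong sum (map-tabulate (λ x → x) g)) (sum-tabulate k g)
  where
  sum-tabulate : ∀ k (g : Fin k → ℕ) → sum (tabulate g) ≡ ∑[ x < k ] g x
  sum-tabulate zero    g = refl
  sum-tabulate (suc k) g = cong (g fzero +_) (sum-tabulate k (g ∘ fsuc))

card-∑ : ∀ {m n} (S : VSet m n) → card S ≡ ∑[ i < m ] ∑[ j < n ] χ (S (i , j))
card-∑ {m} {n} S = trans (sum-map-allFin m _) (sum-cong-≗ (λ i → sum-map-allFin n (λ j → χ (S (i , j)))))

zeros-∑ : ∀ {k} (p : Word k) → zeros p ≡ ∑[ i < k ] χ (isZero (Vec.lookup p i))
zeros-∑ []      = refl
zeros-∑ (x ∷ p) = cong (χ (isZero x) +_) (zeros-∑ p)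

-- at g r is g at position r, and 0 when r ≥ k; atPred d g r is at g (r - 1), and d when r = 0.
at : ∀ {k} → (Fin k → ℕ) → ℕ → ℕ
at {zero}  g r       = 0
at {suc k} g zero    = g fzero
at {suc k} g (suc r) = at (g ∘ fsuc) r

atPred : ∀ {k} → ℕ → (Fin k → ℕ) → ℕ → ℕ
atPred d g zero    = d
atPred d g (suc r) = at g r

at-toℕ : ∀ {k} (g : Fin k → ℕ) (x : Fin k) → at g (toℕ x) ≡ g x
at-toℕ g fzero    = refl
at-toℕ g (fsuc x) = at-toℕ (g ∘ fsuc) x

at-cong : ∀ {k} {f g : Fin k → ℕ} → (∀ x → f x ≡ g x) → ∀ r → at f r ≡ at g r
at-cong {zero}  f≗g r       = refl
at-cong {suc k} f≗g zero    = f≗g fzero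
at-cong {suc k} f≗g (suc r) = at-cong (f≗g ∘ fsuc) r

atPred-cong : ∀ {k} d {f g : Fin k → ℕ} → (∀ x → f x ≡ g x) → ∀ r → atPred d f r ≡ atPred d g r
atPred-cong d f≗g zero    = refl
atPred-cong d f≗g (suc r) = at-cong f≗g r

∑-select : ∀ {k} (g : Fin k → ℕ) r → ∑[ x < k ] when (toℕ x ≡ᵇ r) (g x) ≡ at g r
∑-select {zero}  g r       = refl
∑-select {suc k} g zero    = trans (cong (g fzero +_) (sum-replicate-zero k)) (+-identityʳ (g fzero))
∑-select {suc k} g (suc r) = ∑-select (g ∘ fsuc) r

∑-select′ : ∀ {k} (g : Fin k → ℕ) r → ∑[ x < k ] when (r ≡ᵇ toℕ x) (g x) ≡ at g r
∑-select′ {k} g r = trans (sum-cong-≗ (λ x → cong (λ b → when b (g x)) (≡ᵇ-sym r (toℕ x)))) (∑-select g r)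

∑-select-pred : ∀ {k} (g : Fin k → ℕ) r → ∑[ x < k ] when (suc (toℕ x) ≡ᵇ r) (g x) ≡ atPred 0 g r
∑-select-pred {k} g zero    = sum-replicate-zero k
∑-select-pred     g (suc r) = ∑-select g r

∑-rotate : ∀ n (f : ℕ → ℕ) → ∑[ k < n ] f (suc (toℕ k)) + f 0 ≡ f n + ∑[ k < n ] f (toℕ k)
∑-rotate zero    f = +-comm 0 (f 0)
∑-rotate (suc n) f = begin
  f 1 + ∑[ k < n ] f (suc (suc (toℕ k))) + f 0    ≡⟨ cong (_+ f 0) (+-comm (f 1) _) ⟩
  ∑[ k < n ] f (suc (suc (toℕ k))) + f 1 + f 0    ≡⟨ cong (_+ f 0) (∑-rotate n (f ∘ suc)) ⟩
  f (suc n) + ∑[ k < n ] f (suc (toℕ k)) + f 0    ≡⟨ solve 3 (λ a b c → a :+ b :+ c := a :+ (c :+ b)) refl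
                                                             (f (suc n)) (∑[ k < n ] f (suc (toℕ k))) (f 0) ⟩
  f (suc n) + (f 0 + ∑[ k < n ] f (suc (toℕ k)))  ∎
  where open ≡-Reasoning

∑-shift : ∀ n (f : ℕ → ℕ) → f n ≡ f 0 → ∑[ k < n ] f (suc (toℕ k)) ≡ ∑[ k < n ] f (toℕ k)
∑-shift n f fn≡f0 = +-cancelʳ-≡ (f 0) _ _
  (trans (∑-rotate n f) (trans (cong (_+ ∑[ k < n ] f (toℕ k)) fn≡f0) (+-comm (f 0) _)))

adjPC-disjoint : ∀ a b C E → ((a ≡ᵇ b) ∧ C) ∧ (((suc a ≡ᵇ b) ∨ (suc b ≡ᵇ a)) ∧ E) ≡ false
adjPC-disjoint zero    zero    C E = ∧-zeroʳ C
adjPC-disjoint zero    (suc b) C E = refl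
adjPC-disjoint (suc a) zero    C E = refl
adjPC-disjoint (suc a) (suc b) C E = adjPC-disjoint a b C E

pathAdj-disjoint : ∀ a b → ((suc a ≡ᵇ b) ∧ (suc b ≡ᵇ a)) ≡ false
pathAdj-disjoint zero    zero    = refl
pathAdj-disjoint zero    (suc b) = ∧-zeroʳ (zero ≡ᵇ b)
pathAdj-disjoint (suc a) zero    = refl
pathAdj-disjoint (suc a) (suc b) = pathAdj-disjoint a b

columnχ : ∀ {m n} → VSet m n → Fin n → Fin m → ℕ
columnχ S j i = χ (S (i , j))

-- The number of vertices of S among (i - 1, j), (i + 1, j) and (i, j₀).
countAround : ∀ {m n} → VSet m n → Fin n → Fin n → Fin m → ℕ
countAround S j₀ j i = atPred 0 (columnχ S j) (toℕ i) + at (columnχ S j) (suc (toℕ i)) + χ (S (i , j₀))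

module _ {m n : ℕ} (2≤n : 2 ≤ n) (S : VSet m (suc n)) (i : Fin m) (j : Fin (suc n)) where

  open ≡-Reasoning

  private
    N = suc n

    s : Fin m → Fin N → ℕ
    s i′ j′ = χ (S (i′ , j′))

    col = columnχ S j

    pointwise : ∀ i′ j′ → χ (adjPC m N (i , j) (i′ , j′) ∧ S (i′ , j′))
      ≡ when (eqFin i i′) (when (cycAdj N j j′) (s i′ j′)) + when (pathAdj i i′) (when (eqFin j j′) (s i′ j′))
    pointwise i′ j′ = begin
      χ (adjPC m N (i , j) (i′ , j′) ∧ S (i′ , j′))
        ≡⟨ χ-∧ (adjPC m N (i , j) (i′ , j′)) (S (i′ , j′)) ⟩
      when ((eqFin i i′ ∧ cycAdj N j j′) ∨ (pathAdj i i′ ∧ eqFin j j′)) (s i′ j′)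
        ≡⟨ when-∨ (eqFin i i′ ∧ cycAdj N j j′) (pathAdj i i′ ∧ eqFin j j′) (s i′ j′)
                  (adjPC-disjoint (toℕ i) (toℕ i′) (cycAdj N j j′) (eqFin j j′)) ⟩
      when (eqFin i i′ ∧ cycAdj N j j′) (s i′ j′) + when (pathAdj i i′ ∧ eqFin j j′) (s i′ j′)
        ≡⟨ cong₂ _+_ (when-∧ (eqFin i i′) _ _) (when-∧ (pathAdj i i′) _ _) ⟩
      when (eqFin i i′) (when (cycAdj N j j′) (s i′ j′)) + when (pathAdj i i′) (when (eqFin j j′) (s i′ j′)) ∎

    horizontal : ∑[ j′ < N ] when (cycAdj N j j′) (s i j′) ≡ s i (cycSuc j) + s i (cycPred j)
    horizontal = begin
      ∑[ j′ < N ] when (cycSucc N j j′ ∨ cycSucc N j′ j) (s i j′)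
        ≡⟨ sum-cong-≗ (λ j′ → cong₂ (λ a b → when (a ∨ b) (s i j′))
                                     (cycSucc-cycSuc j j′) (cycSucc-cycPred j j′)) ⟩
      ∑[ j′ < N ] when (j⁺ j′ ∨ j⁻ j′) (s i j′)
        ≡⟨ sum-cong-≗ (λ j′ → when-∨ (j⁺ j′) (j⁻ j′) (s i j′)
                                     (≡ᵇ-disjoint (toℕ j′) (cycSuc≢cycPred 2≤n j))) ⟩
      ∑[ j′ < N ] (when (j⁺ j′) (s i j′) + when (j⁻ j′) (s i j′))
        ≡⟨ ∑-distrib-+ (λ j′ → when (j⁺ j′) (s i j′)) (λ j′ → when (j⁻ j′) (s i j′)) ⟩
      ∑[ j′ < N ] when (j⁺ j′) (s i j′) + ∑[ j′ < N ] when (j⁻ j′) (s i j′)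
        ≡⟨ cong₂ _+_ (trans (∑-select′ (s i) (toℕ (cycSuc j))) (at-toℕ (s i) (cycSuc j)))
                     (trans (∑-select′ (s i) (toℕ (cycPred j))) (at-toℕ (s i) (cycPred j))) ⟩
      s i (cycSuc j) + s i (cycPred j) ∎
      where
      j⁺ j⁻ : Fin N → Bool
      j⁺ j′ = toℕ (cycSuc j) ≡ᵇ toℕ j′
      j⁻ j′ = toℕ (cycPred j) ≡ᵇ toℕ j′

    vertical : ∑[ i′ < m ] when (pathAdj i i′) (col i′) ≡ at col (suc (toℕ i)) + atPred 0 col (toℕ i)
    vertical = begin
      ∑[ i′ < m ] when (below i′ ∨ above i′) (col i′)
        ≡⟨ sum-cong-≗ (λ i′ → when-∨ (below i′) (above i′) (col i′)
                                     (pathAdj-disjoint (toℕ i) (toℕ i′))) ⟩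
      ∑[ i′ < m ] (when (below i′) (col i′) + when (above i′) (col i′))
        ≡⟨ ∑-distrib-+ (λ i′ → when (below i′) (col i′)) (λ i′ → when (above i′) (col i′)) ⟩
      ∑[ i′ < m ] when (below i′) (col i′) + ∑[ i′ < m ] when (above i′) (col i′)
        ≡⟨ cong₂ _+_ (∑-select′ col (suc (toℕ i))) (∑-select-pred col (toℕ i)) ⟩
      at col (suc (toℕ i)) + atPred 0 col (toℕ i) ∎
      where
      below above : Fin m → Bool
      below i′ = suc (toℕ i) ≡ᵇ toℕ i′
      above i′ = suc (toℕ i′) ≡ᵇ toℕ i

  nbrsIn-cycle : nbrsIn S (i , j) ≡ χ (S (i , cycSuc j)) + countAround S (cycPred j) j i
  nbrsIn-cycle = begin
    nbrsIn S (i , j)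
      ≡⟨ card-∑ (λ v → adjPC m N (i , j) v ∧ S v) ⟩
    ∑[ i′ < m ] ∑[ j′ < N ] χ (adjPC m N (i , j) (i′ , j′) ∧ S (i′ , j′))
      ≡⟨ sum-cong-≗ (λ i′ → trans (sum-cong-≗ (pointwise i′)) (∑-distrib-+ (E i′) (P i′))) ⟩
    ∑[ i′ < m ] (∑[ j′ < N ] E i′ j′ + ∑[ j′ < N ] P i′ j′)
      ≡⟨ sum-cong-≗ (λ i′ → cong₂ _+_ (∑-when N (eqFin i i′) (H i′)) (∑-when N (pathAdj i i′) (V i′))) ⟩
    ∑[ i′ < m ] (when (eqFin i i′) (∑H i′) + when (pathAdj i i′) (∑V i′))
      ≡⟨ ∑-distrib-+ (λ i′ → when (eqFin i i′) (∑H i′)) (λ i′ → when (pathAdj i i′) (∑V i′)) ⟩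
    ∑[ i′ < m ] when (eqFin i i′) (∑H i′) + ∑[ i′ < m ] when (pathAdj i i′) (∑V i′)
      ≡⟨ cong₂ _+_ (trans (∑-select′ ∑H (toℕ i)) (trans (at-toℕ ∑H i) horizontal))
                   (trans (sum-cong-≗ (λ i′ → cong (when (pathAdj i i′)) (∑V≡col i′))) vertical) ⟩
    (s i (cycSuc j) + s i (cycPred j)) + (at col (suc (toℕ i)) + atPred 0 col (toℕ i))
      ≡⟨ solve 4 (λ r q b a → (r :+ q) :+ (b :+ a) := r :+ (a :+ b :+ q)) refl
               (s i (cycSuc j)) (s i (cycPred j)) (at col (suc (toℕ i))) (atPred 0 col (toℕ i)) ⟩
    s i (cycSuc j) + (atPred 0 col (toℕ i) + at col (suc (toℕ i)) + s i (cycPred j)) ∎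
    where
    H V E P : Fin m → Fin N → ℕ
    H i′ j′ = when (cycAdj N j j′) (s i′ j′)
    V i′ j′ = when (eqFin j j′) (s i′ j′)
    E i′ j′ = when (eqFin i i′) (H i′ j′)
    P i′ j′ = when (pathAdj i i′) (V i′ j′)

    ∑H ∑V : Fin m → ℕ
    ∑H i′ = ∑[ j′ < N ] H i′ j′
    ∑V i′ = ∑[ j′ < N ] V i′ j′

    ∑V≡col : ∀ i′ → ∑V i′ ≡ col i′
    ∑V≡col i′ = trans (∑-select′ (s i′) (toℕ j)) (at-toℕ (s i′) j)

zeroColumn : ∀ {k} → Word k → Fin k → ℕ
zeroColumn p i = χ (isZero (Vec.lookup p i))

zerosAround : ∀ {k} → Word k → Word k → Fin k → ℕ
zerosAround q p i = zeroM (letterBefore nothing p i) + zeroM (letterAfter p i) + zeroM (just (Vec.lookup q i))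

zeroM-just : ∀ x → zeroM (just x) ≡ χ (isZero x)
zeroM-just 𝟎 = refl
zeroM-just 𝟏 = refl
zeroM-just 𝟐 = refl

zeroM-letterAfter : ∀ {k} (p : Word k) i → zeroM (letterAfter p i) ≡ at (zeroColumn p) (suc (toℕ i))
zeroM-letterAfter (x ∷ [])    fzero    = refl
zeroM-letterAfter (x ∷ y ∷ p) fzero    = zeroM-just y
zeroM-letterAfter (x ∷ p)     (fsuc i) = zeroM-letterAfter p i

zeroM-letterBefore : ∀ {k} pr (p : Word k) i → zeroM (letterBefore pr p i) ≡ atPred (zeroM pr) (zeroColumn p) (toℕ i)
zeroM-letterBefore pr (x ∷ p) fzero    = refl
zeroM-letterBefore pr (x ∷ p) (fsuc i) = trans (zeroM-letterBefore (just x) p i) (shifted i)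
  where
  shifted : ∀ i → atPred (zeroM (just x)) (zeroColumn p) (toℕ i) ≡ at (zeroColumn (x ∷ p)) (toℕ i)
  shifted fzero    = zeroM-just x
  shifted (fsuc i) = refl

module _ {m n : ℕ} (S : VSet m n) (c : Fin n → Word m)
         (c≈S : ∀ i j → isZero (Vec.lookup (c j) i) ≡ S (i , j)) where

  zeroColumn-columnχ : ∀ j i → zeroColumn (c j) i ≡ columnχ S j i
  zeroColumn-columnχ j i = cong χ (c≈S i j)

  zerosAround-countAround : ∀ j₀ j i → zerosAround (c j₀) (c j) i ≡ countAround S j₀ j i
  zerosAround-countAround j₀ j i = cong₂ _+_
    (cong₂ _+_ (trans (zeroM-letterBefore nothing (c j) i) (atPred-cong 0 (zeroColumn-columnχ j) (toℕ i)))
               (trans (zeroM-letterAfter (c j) i) (at-cong (zeroColumn-columnχ j) (suc (toℕ i)))))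
    (trans (zeroM-just (Vec.lookup (c j₀) i)) (zeroColumn-columnχ j₀ i))

  card-columns : card S ≡ ∑[ j < n ] zeros (c j)
  card-columns = begin
    card S                                    ≡⟨ card-∑ S ⟩
    ∑[ i < m ] ∑[ j < n ] χ (S (i , j))       ≡⟨ sum-cong-≗ (λ i → sum-cong-≗ (λ j → sym (zeroColumn-columnχ j i))) ⟩
    ∑[ i < m ] ∑[ j < n ] zeroColumn (c j) i  ≡⟨ ∑-comm (λ i j → zeroColumn (c j) i) ⟩
    ∑[ j < n ] ∑[ i < m ] zeroColumn (c j) i  ≡⟨ sum-cong-≗ (λ j → sym (zeros-∑ (c j))) ⟩
    ∑[ j < n ] zeros (c j)                    ∎
    where open ≡-Reasoning

nbrsIn-columns : ∀ {m n} → 2 ≤ n → (S : VSet m (suc n)) (c : Fin (suc n) → Word m) →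
  (∀ i j → isZero (Vec.lookup (c j) i) ≡ S (i , j)) →
  ∀ i j → nbrsIn S (i , j) ≡ χ (S (i , cycSuc j)) + zerosAround (c (cycPred j)) (c j) i
nbrsIn-columns 2≤n S c c≈S i j =
  trans (nbrsIn-cycle 2≤n S i j)
        (cong (χ (S (i , cycSuc j)) +_) (sym (zerosAround-countAround S c c≈S (cycPred j) j i)))

-- 2-dominating sets as cyclic sequences of words

Cyclic : ∀ {m n} → (Fin (suc n) → Word m) → Set
Cyclic c = ∀ j → canFollow (c (cycPred j)) (c j) ≡ true

zeroSet : ∀ {m n} → (Fin n → Word m) → VSet m n
zeroSet c (i , j) = isZero (Vec.lookup (c j) i)

cond23⇒2≤ : ∀ x k r → isZero x ≡ false → cond23 x k ≡ true → (x ≡ 𝟐 → r ≡ 1) → 2 ≤ r + k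
cond23⇒2≤ 𝟏 k r _ 2≤ᵇk _   = ≤-trans (≤ᵇ-sound 2≤ᵇk) (m≤n+m k r)
cond23⇒2≤ 𝟐 k r _ k≡ᵇ1 r≡1 rewrite ≡ᵇ-sound {k} {1} k≡ᵇ1 | r≡1 refl = ≤-refl

cond1-𝟐 : ∀ y → cond1 𝟐 y ≡ true → isZero y ≡ true
cond1-𝟐 𝟎 _ = refl

cond1-intro : ∀ x y → (x ≡ 𝟐 → isZero y ≡ true) → cond1 x y ≡ true
cond1-intro 𝟎 y _ = refl
cond1-intro 𝟏 y _ = refl
cond1-intro 𝟐 𝟎 _ = refl
cond1-intro 𝟐 𝟏 h = h refl
cond1-intro 𝟐 𝟐 h = h refl

cyclic⇒2-dominating : ∀ {m n} → 2 ≤ n → (c : Fin (suc n) → Word m) → Cyclic c →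
  Is2Dominating m (suc n) (zeroSet c)
cyclic⇒2-dominating 2≤n c c-cyclic (i , j) i∉S =
  subst (2 ≤_) (sym (nbrsIn-columns 2≤n (zeroSet c) c (λ _ _ → refl) i j))
    (cond23⇒2≤ (Vec.lookup (c j) i) _ _ i∉S (∧-conicalʳ (cond1 _ _) _ at-j) next-is-zero)
  where
  at-j : posOK (letterBefore nothing (c j) i) (letterAfter (c j) i)
               (Vec.lookup (c (cycPred j)) i) (Vec.lookup (c j) i) ≡ true
  at-j = followsAux⇒FollowsAt nothing (c (cycPred j)) (c j) (c-cyclic j) i
  j→j⁺ : canFollow (c j) (c (cycSuc j)) ≡ true
  j→j⁺ = subst (λ j₀ → canFollow (c j₀) (c (cycSuc j)) ≡ true) (cycPred-cycSuc j) (c-cyclic (cycSuc j))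
  next-is-zero : Vec.lookup (c j) i ≡ 𝟐 → χ (zeroSet c (i , cycSuc j)) ≡ 1
  next-is-zero cji≡𝟐 = cong χ (cond1-𝟐 _ (subst (λ x → cond1 x (Vec.lookup (c (cycSuc j)) i) ≡ true) cji≡𝟐
    (∧-conicalˡ _ _ (followsAux⇒FollowsAt nothing (c j) (c (cycSuc j)) j→j⁺ i))))

label : Bool → ℕ → Letter
label true  _ = 𝟎
label false k = if 2 ≤ᵇ k then 𝟏 else 𝟐

isZero-label : ∀ b k → isZero (label b k) ≡ b
isZero-label true  k = refl
isZero-label false k with 2 ≤ᵇ k
... | true  = refl
... | false = refl

label≡𝟐 : ∀ b k → label b k ≡ 𝟐 → b ≡ false × k < 2
label≡𝟐 false k h with 2 ≤ᵇ k in 2≤ᵇk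
... | false = refl , ≤ᵇ-false 2≤ᵇk

cond23-label : ∀ b k → (b ≡ false → 1 ≤ k) → cond23 (label b k) k ≡ true
cond23-label true  k _ = refl
cond23-label false k h with 2 ≤ᵇ k in 2≤ᵇk
... | true  = 2≤ᵇk
... | false = ≡ᵇ-complete (≤-antisym (s≤s⁻¹ (≤ᵇ-false 2≤ᵇk)) (h refl))

module _ {m n : ℕ} (S : VSet m (suc n)) where

  labelling : Fin (suc n) → Word m
  labelling j = Vec.tabulate (λ i → label (S (i , j)) (countAround S (cycPred j) j i))

  lookup-labelling : ∀ i j → Vec.lookup (labelling j) i ≡ label (S (i , j)) (countAround S (cycPred j) j i)
  lookup-labelling i j = lookup∘tabulate _ i

  labelling≈S : ∀ i j → isZero (Vec.lookup (labelling j) i) ≡ S (i , j)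
  labelling≈S i j = trans (cong isZero (lookup-labelling i j)) (isZero-label _ _)

  card-labelling : card S ≡ ∑[ j < suc n ] zeros (labelling j)
  card-labelling = card-columns S labelling labelling≈S

  module _ (2≤n : 2 ≤ n) (S-dom : Is2Dominating m (suc n) S) where

    private
      dominated : ∀ i j → S (i , j) ≡ false → 2 ≤ χ (S (i , cycSuc j)) + countAround S (cycPred j) j i
      dominated i j i∉S = subst (2 ≤_) (nbrsIn-cycle 2≤n S i j) (S-dom (i , j) i∉S)

      𝟐-forces-next : ∀ i j → label (S (i , j)) (countAround S (cycPred j) j i) ≡ 𝟐 → S (i , cycSuc j) ≡ true
      𝟐-forces-next i j is-𝟐 with label≡𝟐 _ _ is-𝟐
      ... | i∉S , count<2 = χ-positive _ (+-cancelʳ-≤ _ 1 _ (≤-trans count<2 (dominated i j i∉S)))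

    labelling-cyclic : Cyclic labelling
    labelling-cyclic j =
      FollowsAt⇒followsAux nothing (labelling (cycPred j)) (labelling j) (λ i → ∧-intro (cond1-at i) (cond23-at i))
      where
      cond1-at : ∀ i → cond1 (Vec.lookup (labelling (cycPred j)) i) (Vec.lookup (labelling j) i) ≡ true
      cond1-at i = cond1-intro _ _ λ is-𝟐 → trans (labelling≈S i j)
        (subst (λ j′ → S (i , j′) ≡ true) (cycSuc-cycPred j)
          (𝟐-forces-next i (cycPred j) (trans (sym (lookup-labelling i (cycPred j))) is-𝟐)))
      cond23-at : ∀ i → cond23 (Vec.lookup (labelling j) i) (zerosAround (labelling (cycPred j)) (labelling j) i) ≡ true
      cond23-at i rewrite lookup-labelling i j | zerosAround-countAround S labelling labelling≈S (cycPred j) j i =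
        cond23-label (S (i , j)) _ λ i∉S →
          s≤s⁻¹ (≤-trans (dominated i j i∉S) (+-monoˡ-≤ _ (χ≤1 (S (i , cycSuc j)))))

-- γ₂ from the diagonal of A(D_m)^n

cyclic⇒power-≤∞ : ∀ {m n} (c : Fin (suc n) → Word m) → Cyclic c →
  (AD m ^ suc n) (c fzero) (c fzero) ≤∞ ∑[ j < suc n ] zeros (c j)
cyclic⇒power-≤∞ {m} {n} c c-cyclic =
  subst₂ (λ p x → (AD m ^ suc n) (c fzero) p ≤∞ x) (cong c cycSuc^-period) weight-w (power-≤∞-weight (suc n) w)
  where
  w : Walk m (suc n)
  w = record
    { vertex = c ∘ cycSuc^
    ; step   = λ k _ → subst (λ j → canFollow (c j) (c (cycSuc (cycSuc^ k))) ≡ true)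
                             (cycPred-cycSuc (cycSuc^ k)) (c-cyclic (cycSuc (cycSuc^ k)))
    }
  weight-w : weight w ≡ ∑[ j < suc n ] zeros (c j)
  weight-w = trans (∑-shift (suc n) (zeros ∘ c ∘ cycSuc^) (cong (zeros ∘ c) cycSuc^-period))
                   (sum-cong-≗ (cong (zeros ∘ c) ∘ cycSuc^-toℕ))

finite-power⇒cyclic : ∀ {m n} {q : Word m} {x} → (AD m ^ suc n) q q ≡ fin x →
  Σ[ c ∈ (Fin (suc n) → Word m) ] Cyclic c × ∑[ j < suc n ] zeros (c j) ≡ x
finite-power⇒cyclic {m} {n} h with finite-power⇒walk (suc n) h
... | w , src , tgt , weight≡x =
  vertex w ∘ toℕ , cyclic , trans (sym (∑-shift (suc n) (zeros ∘ vertex w) (cong zeros closed))) weight≡x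
  where
  closed : target w ≡ source w
  closed = trans tgt (sym src)
  cyclic : Cyclic (vertex w ∘ toℕ)
  cyclic fzero    = subst₂ (λ k p → canFollow (vertex w k) p ≡ true) (sym (toℕ-fromℕ n)) closed (step w n ≤-refl)
  cyclic (fsuc j) = subst (λ k → canFollow (vertex w k) (vertex w (suc (toℕ j))) ≡ true) (sym (toℕ-inject₁ j))
                          (step w (toℕ j) (m<n⇒m<1+n (toℕ<n j)))

2-dominating⇒diagonal : ∀ {m n} → 2 ≤ n → (S : VSet m (suc n)) → Is2Dominating m (suc n) S →
  ∃[ q ] correct q ≡ true × (AD m ^ suc n) q q ≤∞ card S
2-dominating⇒diagonal {m} {n} 2≤n S S-dom =
  c fzero , canFollow⇒correct (c (cycPred fzero)) (c fzero) (c-cyclic fzero) ,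
  subst ((AD m ^ suc n) (c fzero) (c fzero) ≤∞_) (sym (card-labelling S)) (cyclic⇒power-≤∞ c c-cyclic)
  where
  c = labelling S
  c-cyclic = labelling-cyclic S 2≤n S-dom

diagonal⇒2-dominating : ∀ {m n} → 2 ≤ n → {q : Word m} {x : ℕ} → (AD m ^ suc n) q q ≡ fin x →
  ∃[ S ] Is2Dominating m (suc n) S × card S ≡ x
diagonal⇒2-dominating 2≤n h =
  let c , c-cyclic , weight≡x = finite-power⇒cyclic h
  in zeroSet c , cyclic⇒2-dominating 2≤n c c-cyclic , trans (card-columns (zeroSet c) c (λ _ _ → refl)) weight≡x

γ₂-≤-diagonal : ∀ {m n k} → 2 ≤ n → IsGamma2PC m (suc n) k →
  {q : Word m} {x : ℕ} → (AD m ^ suc n) q q ≡ fin x → k ≤ x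
γ₂-≤-diagonal {k = k} 2≤n (_ , minimal) h =
  let S , S-dom , |S|≡x = diagonal⇒2-dominating 2≤n h
  in subst (k ≤_) |S|≡x (minimal S S-dom)

γ₂-attained-on-diagonal : ∀ {m n k} → 2 ≤ n → IsGamma2PC m (suc n) k →
  ∃₂ λ q x → correct q ≡ true × (AD m ^ suc n) q q ≡ fin x × x ≤ k
γ₂-attained-on-diagonal 2≤n ((S , S-dom , |S|≡k) , _) =
  let q , q-correct , x , Aqq≡x , x≤|S| = 2-dominating⇒diagonal 2≤n S S-dom
  in q , x , q-correct , Aqq≡x , subst (x ≤_) |S|≡k x≤|S|

theorem4 : (m : ℕ) → 2 ≤ m → (n₀ a b : ℕ) →
    (∀ (q p : Word m) → correct q ≡ true → correct p ≡ true →
      (AD m ^ (n₀ + a)) q p ≡ (b · (AD m ^ n₀)) q p) →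
    (n : ℕ) → n₀ ≤ n → 3 ≤ n →
    ∀ (k k′ : ℕ) → IsGamma2PC m n k → IsGamma2PC m (n + a) k′ → k′ ≡ k + b
theorem4 m _ n₀ a b periodic (suc n) n₀≤n (s≤s 2≤n) k k′ γ₂≡k γ₂′≡k′ = ≤-antisym k′≤k+b k+b≤k′
  where
  open ≤-Reasoning
  2≤n+a = ≤-trans 2≤n (m≤m+n n a)

  shifted : ∀ q → correct q ≡ true → (AD m ^ (suc n + a)) q q ≡ fin b ⊗ (AD m ^ suc n) q q
  shifted q q-correct = ^-periodic (AD m) periodic (≤⇒≤′ n₀≤n) q q q-correct q-correct

  k′≤k+b : k′ ≤ k + b
  k′≤k+b =
    let q , x , q-correct , Aqq≡x , x≤k = γ₂-attained-on-diagonal 2≤n γ₂≡k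
    in begin
      k′     ≤⟨ γ₂-≤-diagonal 2≤n+a γ₂′≡k′ (trans (shifted q q-correct) (cong (fin b ⊗_) Aqq≡x)) ⟩
      b + x  ≡⟨ +-comm b x ⟩
      x + b  ≤⟨ +-monoˡ-≤ b x≤k ⟩
      k + b  ∎

  k+b≤k′ : k + b ≤ k′
  k+b≤k′ =
    let q , x′ , q-correct , A′qq≡x′ , x′≤k′ = γ₂-attained-on-diagonal 2≤n+a γ₂′≡k′
        x , Aqq≡x , b+x≡x′ = fin⊗-finite b (trans (sym (shifted q q-correct)) A′qq≡x′)
    in begin
      k + b  ≤⟨ +-monoˡ-≤ b (γ₂-≤-diagonal 2≤n γ₂≡k Aqq≡x) ⟩
      x + b  ≡⟨ +-comm x b ⟩
      b + x  ≡⟨ b+x≡x′ ⟩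
      x′     ≤⟨ x′≤k′ ⟩
      k′     ∎
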